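{- Let $n=2^\alpha$ with $\alpha\ge2$ and $D_n=\langle a,b\mid a^n=b^2=1,\ ab=ba^{ -1}\rangle$. Then each connected component of $\Gamma_N(D_n)$ contains a Hamiltonian path.
   Context: $\Gamma_N(G)$ denotes the simple graph whose vertices are the proper non-normal subgroups of the group $G$, two distinct vertices $H,K$ being adjacent iff $HK=KH$. A Hamiltonian path in a graph is a path through all of its vertices. -}

module Defs where

open import Data.Nat using (ℕ; zero; suc; _+_; _∸_; NonZero)
open import Data.Nat.DivMod using (_%_; m%n<n)
open import Data.Fin using (Fin; toℕ; fromℕ<)
open import Data.Bool using (Bool; true; false; _xor_)
open import Data.Product using (Σ; _×_; _,_; ∃; ∃-syntax)
open import Data.List using (List; []; _∷_; length; lookup)
open import Data.Empty using (⊥)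
open import Relation.Nullary using (¬_)
open import Relation.Binary.PropositionalEquality using (_≡_)

-- The dihedral group D_n = ⟨a, b ∣ a^n = b^2 = 1, ab = ba⁻¹⟩ of order 2n,
-- realised concretely by its normal form a^i b^e (i ∈ ℤ/n, e ∈ {0,1}).
-- (i , false) stands for a^i and (i , true) for a^i b.

module Dihedral (n : ℕ) .{{_ : NonZero n}} where

  Elem : Set
  Elem = Fin n × Bool

  modn : ℕ → Fin n
  modn k = fromℕ< (m%n<n k n)

  addF : Fin n → Fin n → Fin n
  addF i j = modn (toℕ i + toℕ j)

  negF : Fin n → Fin n
  negF j = modn (n ∸ toℕ j)

  -- b^e a^j = a^{(-1)^e j} b^e
  twist : Bool → Fin n → Fin n
  twist false j = j
  twist true  j = negF j

  -- (a^i b^e)(a^j b^f) = a^{i + (-1)^e j} b^{e+f}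
  _·_ : Elem → Elem → Elem
  (i , e) · (j , f) = addF i (twist e j) , (e xor f)

  one : Elem
  one = modn 0 , false

  inv : Elem → Elem
  inv (i , false) = negF i , false
  inv (i , true)  = i , true

  Subset : Set
  Subset = Elem → Bool

  _∈_ : Elem → Subset → Set
  x ∈ S = S x ≡ true

  _≋_ : Subset → Subset → Set
  S ≋ T = ∀ x → S x ≡ T x

  record IsSubgroup (H : Subset) : Set where
    field
      one∈ : one ∈ H
      ·∈   : ∀ x y → x ∈ H → y ∈ H → (x · y) ∈ H
      inv∈ : ∀ x → x ∈ H → inv x ∈ H

  IsProper : Subset → Set
  IsProper H = ∃[ x ] ¬ (x ∈ H)

  IsNormal : Subset → Set
  IsNormal H = ∀ g h → h ∈ H → ((g · h) · inv g) ∈ H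

  IsVertex : Subset → Set
  IsVertex H = IsSubgroup H × IsProper H × ¬ IsNormal H

  _∈[_·_] : Elem → Subset → Subset → Set
  x ∈[ H · K ] = ∃[ h ] ∃[ k ] (h ∈ H × k ∈ K × x ≡ h · k)

  Permutable : Subset → Subset → Set
  Permutable H K = ∀ x → (x ∈[ H · K ] → x ∈[ K · H ]) × (x ∈[ K · H ] → x ∈[ H · K ])

  Adj : Subset → Subset → Set
  Adj H K = IsVertex H × IsVertex K × ¬ (H ≋ K) × Permutable H K

  data Connected : Subset → Subset → Set where
    here : ∀ {H} → IsVertex H → Connected H H
    step : ∀ {H K L} → Adj H K → Connected K L → Connected H L

  data IsPath : List Subset → Set where
    single : ∀ {H} → IsVertex H → IsPath (H ∷ [])
    cons   : ∀ {H K Ks} → Adj H K → IsPath (K ∷ Ks) → IsPath (H ∷ K ∷ Ks)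

  record HamiltonianPathOfComponent (V : Subset) (P : List Subset) : Set where
    field
      isPath   : IsPath P
      inComp   : ∀ i → Connected V (lookup P i)
      distinct : ∀ i j → lookup P i ≋ lookup P j → i ≡ j
      covers   : ∀ W → Connected V W → ∃[ i ] (lookup P i ≋ W)

module Submission where

-- An element a^i b^e of D_n is handled through its integer exponent i, so group
-- identities become congruences of integers (proved with the ring solver).  For
-- arbitrary n we show: every vertex is Std m r = ⟨a^m, a^r b⟩ with m ∣ n, m ∤ 2
-- (classify); Std M r ⊂ Std m r is an edge; Std 2m r and Std M q are adjacent when
-- 2m ∣ M and q ≡ r + m (mod 2m), as both lie in Std m r where Std 2m r has index 2;
-- and permuting Std m r, Std M q with 4 ∣ m, M have r ≡ q (mod 2) (Std-parity).
-- For n = 2^α the vertices are the codes (s , r), 2 ≤ s ≤ α, r mod 2^s, arranged in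
-- binary trees where (s , r) has the children (s+1 , r) and (s+1 , r + 2^s).  The
-- component of (s , c) consists of the codes with r ≡ c (mod 2): the trees rooted at
-- (2 , c) and (2 , c + 2).  Their preorder listing is the Hamiltonian path, since a
-- node is adjacent to its first child, and every node under the first child is
-- adjacent to the second child.

open import Defs
open import Data.Nat using (ℕ; _≤_; _^_)
open import Data.Nat.Properties using (m^n≢0)
open import Data.List using (List)
open import Data.Product using (∃-syntax)

open import Data.Nat as ℕ using (zero; suc; _<_; z≤n; s≤s; NonZero)
import Data.Nat.Properties as ℕ
open import Data.Nat.DivMod using (_%_; _/_; m≡m%n+[m/n]*n; m<n⇒m%n≡m; m%n<n)
import Data.Nat.Divisibility as ℕ
open import Data.Nat.Divisibility using (_∣_)
open import Data.Nat.Coprimality using (Coprime; coprime-divisor)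
open import Data.Integer using (ℤ; +_; 0ℤ; -1ℤ; _+_; _-_; _*_; -_; ∣_∣; _%ℕ_; _/ℕ_; _⊖_)
open import Data.Integer.Properties
  using (pos-*; *-cancelˡ-≡; *-identityˡ; +-identityˡ; +-identityʳ; +-assoc; -1*i≡-i; m-n≡m⊖n; ⊖-≥;
         ∣m⊝n∣≤m⊔n; ∣i∣≡0⇒i≡0; i-j≡0⇒i≡j; +-injective)
open import Data.Integer.DivMod using (a≡a%ℕn+[a/ℕn]*n; n%ℕd<d)
open import Data.Integer.Divisibility.Signed renaming (_∣_ to _∣ℤ_)
  using (divides; ∣ᵤ⇒∣; ∣⇒∣ᵤ; ∣-refl; ∣-trans; ∣m∣n⇒∣m+n; ∣m⇒∣-m; ∣n⇒∣m*n; ∣m⇒∣m*n)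
open import Data.Integer.Tactic.RingSolver using (solve-∀)
open import Data.Fin as Fin using (Fin; toℕ; fromℕ<)
open import Data.Fin.Properties using (toℕ-fromℕ<; toℕ<n; toℕ-injective; any?)
open import Data.Bool as Bool using (Bool; true; false; _xor_)
open import Data.Product using (_×_; _,_; proj₁; proj₂)
open import Data.Sum using (_⊎_; inj₁; inj₂)
open import Data.Empty using (⊥-elim)
open import Data.List using ([]; _∷_; _++_; map; lookup)
open import Data.List.Membership.Propositional.Properties using (∈-lookup)
import Data.List.Relation.Unary.All as All
open All using (All; []; _∷_)
import Data.List.Relation.Unary.All.Properties as Allₚ
import Data.List.Relation.Unary.AllPairs as AllPairs
open AllPairs using (AllPairs; []; _∷_)
import Data.List.Relation.Unary.AllPairs.Properties as AllPairsₚ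
import Data.List.Relation.Unary.Any as Any
open Any using (Any; here; there)
import Data.List.Relation.Unary.Any.Properties as Anyₚ
open import Function using (_∘_; mk⇔)
open import Relation.Nullary using (¬_; Dec; yes; no; does)
open import Relation.Nullary.Decidable using (map′; dec-true; does-⇔)
open import Relation.Unary using (Decidable)
open import Relation.Binary.Bundles using (Setoid)
open import Relation.Binary.Definitions using (tri<; tri≈; tri>)
open import Relation.Binary.PropositionalEquality
  using (_≡_; _≢_; refl; sym; trans; cong; subst; module ≡-Reasoning)
import Relation.Binary.Reasoning.Setoid as SetoidReasoning

infix 4 _≡_mod_

-- a ≡ b mod m : the integer m divides a - b.  (A record rather than a
-- definition, so that a and b can be inferred from a congruence.)
record _≡_mod_ (a b : ℤ) (m : ℕ) : Set where
  constructor mod-by-divisor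
  field divides-difference : + m ∣ℤ a - b
open _≡_mod_ public

module _ {m : ℕ} where

  mod-by : ∀ {a b c} → a - b ≡ c → + m ∣ℤ c → a ≡ b mod m
  mod-by eq p = mod-by-divisor (subst (+ m ∣ℤ_) (sym eq) p)

  mod-reflexive : ∀ {a b} → a ≡ b → a ≡ b mod m
  mod-reflexive {a} refl = mod-by-divisor (divides 0ℤ (a-a≡0 a))
    where
    a-a≡0 : ∀ a → a - a ≡ 0ℤ
    a-a≡0 = solve-∀

  mod-sym : ∀ {a b} → a ≡ b mod m → b ≡ a mod m
  mod-sym {a} {b} p = mod-by (flip a b) (∣m⇒∣-m (divides-difference p))
    where
    flip : ∀ a b → b - a ≡ - (a - b)
    flip = solve-∀

  mod-trans : ∀ {a b c} → a ≡ b mod m → b ≡ c mod m → a ≡ c mod m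
  mod-trans {a} {b} {c} p q =
    mod-by (telescope a b c) (∣m∣n⇒∣m+n (divides-difference p) (divides-difference q))
    where
    telescope : ∀ a b c → a - c ≡ (a - b) + (b - c)
    telescope = solve-∀

  +-cong-mod : ∀ {a b c d} → a ≡ b mod m → c ≡ d mod m → a + c ≡ b + d mod m
  +-cong-mod {a} {b} {c} {d} p q =
    mod-by (regroup a b c d) (∣m∣n⇒∣m+n (divides-difference p) (divides-difference q))
    where
    regroup : ∀ a b c d → (a + c) - (b + d) ≡ (a - b) + (c - d)
    regroup = solve-∀

  +-congˡ-mod : ∀ a {b c} → b ≡ c mod m → a + b ≡ a + c mod m
  +-congˡ-mod a = +-cong-mod (mod-reflexive {a} refl)

  +-congʳ-mod : ∀ c {a b} → a ≡ b mod m → a + c ≡ b + c mod m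
  +-congʳ-mod c p = +-cong-mod p (mod-reflexive {c} refl)

  neg-cong-mod : ∀ {a b} → a ≡ b mod m → - a ≡ - b mod m
  neg-cong-mod {a} {b} p = mod-by (flip a b) (∣m⇒∣-m (divides-difference p))
    where
    flip : ∀ a b → - a - - b ≡ - (a - b)
    flip = solve-∀

  *-cong-mod : ∀ c {a b} → a ≡ b mod m → c * a ≡ c * b mod m
  *-cong-mod c {a} {b} p = mod-by (distrib c a b) (∣n⇒∣m*n c (divides-difference p))
    where
    distrib : ∀ c a b → c * a - c * b ≡ c * (a - b)
    distrib = solve-∀

  mod-offset : ∀ a q → a + q * + m ≡ a mod m
  mod-offset a q = mod-by-divisor (divides q (cancel a q (+ m)))
    where
    cancel : ∀ a q M → a + q * M - a ≡ q * M
    cancel = solve-∀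

  mod-divisor : ∀ {k a b} → k ∣ m → a ≡ b mod m → a ≡ b mod k
  mod-divisor k∣m p = mod-by-divisor (∣-trans (∣ᵤ⇒∣ k∣m) (divides-difference p))

  ≡0-mod⇒∣ : ∀ {k} → + k ≡ 0ℤ mod m → m ∣ k
  ≡0-mod⇒∣ {k} p = subst (m ℕ.∣_) (ℕ.+-identityʳ k) (∣⇒∣ᵤ (divides-difference p))

  modulus≡0 : + m ≡ 0ℤ mod m
  modulus≡0 = mod-by-divisor (divides (+ 1) (m-0 (+ m)))
    where
    m-0 : ∀ M → M - 0ℤ ≡ + 1 * M
    m-0 = solve-∀

  ∣⇒≡0-mod : ∀ {a} → + m ∣ℤ a → a ≡ 0ℤ mod m
  ∣⇒≡0-mod {a} = mod-by (+-identityʳ a)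

  +-cancelˡ-mod : ∀ a {b c} → a + b ≡ a + c mod m → b ≡ c mod m
  +-cancelˡ-mod a {b} {c} p = mod-by (cancel a b c) (divides-difference p)
    where
    cancel : ∀ a b c → b - c ≡ (a + b) - (a + c)
    cancel = solve-∀

  +-multiple-mod : ∀ r {k} → m ∣ k → r + + k ≡ r mod m
  +-multiple-mod r m∣k =
    mod-trans (+-congˡ-mod r (∣⇒≡0-mod (∣ᵤ⇒∣ m∣k))) (mod-reflexive (+-identityʳ r))

  even≡0 : m ∣ 2 → ∀ a → + 2 * a ≡ 0ℤ mod m
  even≡0 m∣2 a = ∣⇒≡0-mod (∣-trans (∣ᵤ⇒∣ m∣2) (∣m⇒∣m*n a (∣-refl {+ 2})))

double≡0 : ∀ {m} → + m + + m ≡ 0ℤ mod (2 ℕ.* m)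
double≡0 {m} = ∣⇒≡0-mod (subst (+ (2 ℕ.* m) ∣ℤ_) (trans (pos-* 2 m) (twice (+ m))) ∣-refl)
  where
  twice : ∀ M → + 2 * M ≡ M + M
  twice = solve-∀

≟-mod : ∀ m a b → Dec (a ≡ b mod m)
≟-mod m a b = map′ (mod-by-divisor ∘ ∣ᵤ⇒∣) (∣⇒∣ᵤ ∘ divides-difference) (m ℕ.∣? ∣ a - b ∣)

mod-setoid : ℕ → Setoid _ _
mod-setoid m = record
  { _≈_ = (_≡_mod m)
  ; isEquivalence = record { refl = mod-reflexive refl ; sym = mod-sym ; trans = mod-trans } }

module ModReasoning (m : ℕ) = SetoidReasoning (mod-setoid m)

mod-split : ∀ {m a b} → a ≡ b mod m → a ≡ b mod (2 ℕ.* m) ⊎ a ≡ b + + m mod (2 ℕ.* m)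
mod-split {m} {a} {b} (mod-by-divisor (divides q a-b≡qm))
  with q %ℕ 2 | n%ℕd<d q 2 | a≡a%ℕn+[a/ℕn]*n q 2
... | 0 | _ | q≡2h = inj₁ (mod-by-divisor (divides h (begin
  a - b                   ≡⟨ a-b≡qm ⟩
  q * + m                 ≡⟨ cong (_* + m) q≡2h ⟩
  (+ 0 + h * + 2) * + m   ≡⟨ even h (+ m) ⟩
  h * (+ 2 * + m)         ≡⟨ cong (h *_) (pos-* 2 m) ⟨
  h * + (2 ℕ.* m)         ∎)))
  where
  open ≡-Reasoning
  h = q /ℕ 2
  even : ∀ h M → (+ 0 + h * + 2) * M ≡ h * (+ 2 * M)
  even = solve-∀
... | 1 | _ | q≡2h+1 = inj₂ (mod-by-divisor (divides h (begin
  a - (b + + m)               ≡⟨ shift a b (+ m) ⟩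
  (a - b) - + m               ≡⟨ cong (λ x → x - + m) (trans a-b≡qm (cong (_* + m) q≡2h+1)) ⟩
  (+ 1 + h * + 2) * + m - + m ≡⟨ odd h (+ m) ⟩
  h * (+ 2 * + m)             ≡⟨ cong (h *_) (pos-* 2 m) ⟨
  h * + (2 ℕ.* m)             ∎)))
  where
  open ≡-Reasoning
  h = q /ℕ 2
  shift : ∀ a b M → a - (b + M) ≡ (a - b) - M
  shift = solve-∀
  odd : ∀ h M → (+ 1 + h * + 2) * M - M ≡ h * (+ 2 * M)
  odd = solve-∀
... | suc (suc _) | ℕ.s≤s (ℕ.s≤s ()) | _

mod-halve : ∀ {m a b} → + 2 * a ≡ + 2 * b mod (2 ℕ.* m) → a ≡ b mod m
mod-halve {m} {a} {b} (mod-by-divisor (divides q eq)) =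
  mod-by-divisor (divides q (*-cancelˡ-≡ (+ 2) (a - b) (q * + m) (begin
    + 2 * (a - b)           ≡⟨ distrib a b ⟩
    + 2 * a - + 2 * b       ≡⟨ eq ⟩
    q * + (2 ℕ.* m)         ≡⟨ cong (q *_) (pos-* 2 m) ⟩
    q * (+ 2 * + m)         ≡⟨ reassoc q (+ m) ⟩
    + 2 * (q * + m)         ∎)))
  where
  open ≡-Reasoning
  distrib : ∀ a b → + 2 * (a - b) ≡ + 2 * a - + 2 * b
  distrib = solve-∀
  reassoc : ∀ q M → q * (+ 2 * M) ≡ + 2 * (q * M)
  reassoc = solve-∀

mod-antisym-halve : ∀ {m r q} → r - q ≡ q - r mod (2 ℕ.* m) → r ≡ q mod m
mod-antisym-halve {m} {r} {q} p = mod-halve (mod-by (regroup r q) (divides-difference p))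
  where
  regroup : ∀ r q → + 2 * r - + 2 * q ≡ (r - q) - (q - r)
  regroup = solve-∀

Least : (ℕ → Set) → ℕ → Set
Least P m = P m × (∀ {j} → j ℕ.< m → ¬ P j)

least : ∀ {P : ℕ → Set} → Decidable P → ∀ b → P b → ∃[ m ] Least P m
least P? zero    p = zero , p , λ ()
least P? (suc b) p with P? zero
... | yes p₀ = zero , p₀ , λ ()
... | no ¬p₀ with least (λ j → P? (suc j)) b p
...   | m , pm , below = suc m , pm , λ { {zero} _ → ¬p₀ ; {suc j} (ℕ.s≤s j<m) → below j<m }

pow-∣ : ∀ {s t} → s ≤ t → 2 ^ s ∣ 2 ^ t
pow-∣ {t = t} z≤n      = ℕ.1∣ (2 ^ t)
pow-∣         (s≤s s≤t) = ℕ.*-monoʳ-∣ 2 (pow-∣ s≤t)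

pow-< : ∀ {s t} → s < t → 2 ^ s < 2 ^ t
pow-< = ℕ.^-monoʳ-< 2 (s≤s (s≤s z≤n))

pow-injective : ∀ {s t} → 2 ^ s ≡ 2 ^ t → s ≡ t
pow-injective {s} {t} e with ℕ.<-cmp s t
... | tri< s<t _ _ = ⊥-elim (ℕ.<-irrefl e (pow-< s<t))
... | tri≈ _ s≡t _ = s≡t
... | tri> _ _ t<s = ⊥-elim (ℕ.<-irrefl (sym e) (pow-< t<s))

pow-suc∤ : ∀ s → ¬ 2 ^ suc s ∣ 2 ^ s
pow-suc∤ s d = ℕ.<⇒≱ (pow-< (ℕ.n<1+n s)) (ℕ.∣⇒≤ {{m^n≢0 2 s}} d)

pow∤2 : ∀ {s} → 2 ≤ s → ¬ 2 ^ s ∣ 2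
pow∤2 {s} 2≤s d = ℕ.<⇒≱ (ℕ.<-≤-trans (s≤s (s≤s (s≤s z≤n))) (ℕ.^-monoʳ-≤ 2 2≤s)) (ℕ.∣⇒≤ d)

pow∤2⇒2≤ : ∀ {s} → ¬ 2 ^ s ∣ 2 → 2 ≤ s
pow∤2⇒2≤ {zero}        1∤2 = ⊥-elim (1∤2 (ℕ.1∣ 2))
pow∤2⇒2≤ {suc zero}    2∤2 = ⊥-elim (2∤2 ℕ.∣-refl)
pow∤2⇒2≤ {suc (suc s)} _   = s≤s (s≤s z≤n)

odd⇒coprime : ∀ {m} → ¬ 2 ∣ m → Coprime m 2
odd⇒coprime 2∤m {zero}  (_ , 0∣2)  = ⊥-elim (ℕ.1+n≢0 (ℕ.0∣⇒≡0 0∣2))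
odd⇒coprime 2∤m {1}     _          = refl
odd⇒coprime 2∤m {2}     (2∣m , _)  = ⊥-elim (2∤m 2∣m)
odd⇒coprime 2∤m {suc (suc (suc i))} (_ , i∣2) with ℕ.∣⇒≤ i∣2
... | s≤s (s≤s ())

divisor-of-power : ∀ a {m} → m ∣ 2 ^ a → ∃[ s ] (s ≤ a × m ≡ 2 ^ s)
divisor-of-power zero    m∣1 = 0 , z≤n , ℕ.∣1⇒≡1 m∣1
divisor-of-power (suc a) {m} m∣2^a+1 with 2 ℕ.∣? m
... | yes (ℕ.divides h m≡h2) =
  let (s , s≤a , h≡2^s) = divisor-of-power a (ℕ.*-cancelˡ-∣ {h} 2 (subst (_∣ 2 ^ suc a) m≡2h m∣2^a+1))
  in suc s , s≤s s≤a , trans m≡2h (cong (2 ℕ.*_) h≡2^s)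
  where
  m≡2h : m ≡ 2 ℕ.* h
  m≡2h = trans m≡h2 (ℕ.*-comm h 2)
... | no 2∤m =
  let (s , s≤a , m≡2^s) = divisor-of-power a (coprime-divisor (odd⇒coprime 2∤m) m∣2^a+1)
  in s , ℕ.m≤n⇒m≤1+n s≤a , m≡2^s

module DihedralFacts (n : ℕ) .{{_ : NonZero n}} where

  open Dihedral n public
  module _ where
    open ModReasoning n

    ⟦_⟧ : Fin n → ℤ
    ⟦ i ⟧ = + toℕ i

    point : ℤ → Fin n
    point a = fromℕ< (n%ℕd<d a n)

    -- the sign (-1)^e by which b^e acts on exponents
    σ : Bool → ℤ
    σ false = + 1
    σ true  = -1ℤ

    ⟦point⟧ : ∀ a → ⟦ point a ⟧ ≡ a mod n
    ⟦point⟧ a = begin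
      ⟦ point a ⟧                   ≡⟨ cong +_ (toℕ-fromℕ< _) ⟩
      + (a %ℕ n)                    ≈⟨ mod-offset (+ (a %ℕ n)) (a /ℕ n) ⟨
      + (a %ℕ n) + (a /ℕ n) * + n   ≡⟨ a≡a%ℕn+[a/ℕn]*n a n ⟨
      a                             ∎

    ⟦modn⟧ : ∀ k → ⟦ modn k ⟧ ≡ + k mod n
    ⟦modn⟧ k = begin
      ⟦ modn k ⟧                    ≡⟨ cong +_ (toℕ-fromℕ< _) ⟩
      + (k % n)                     ≈⟨ mod-offset (+ (k % n)) (+ (k / n)) ⟨
      + (k % n) + + (k / n) * + n   ≡⟨ cong (λ x → + (k % n) + x) (pos-* (k / n) n) ⟨
      + (k % n ℕ.+ k / n ℕ.* n)     ≡⟨ cong +_ (m≡m%n+[m/n]*n k n) ⟨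
      + k                           ∎

    ⟦addF⟧ : ∀ i j → ⟦ addF i j ⟧ ≡ ⟦ i ⟧ + ⟦ j ⟧ mod n
    ⟦addF⟧ i j = ⟦modn⟧ (toℕ i ℕ.+ toℕ j)

    ⟦negF⟧ : ∀ j → ⟦ negF j ⟧ ≡ - ⟦ j ⟧ mod n
    ⟦negF⟧ j = begin
      ⟦ negF j ⟧                    ≈⟨ ⟦modn⟧ (n ℕ.∸ toℕ j) ⟩
      + (n ℕ.∸ toℕ j)               ≡⟨ ⊖-≥ (ℕ.<⇒≤ (toℕ<n j)) ⟨
      n ⊖ toℕ j                     ≡⟨ m-n≡m⊖n n (toℕ j) ⟨
      + n - ⟦ j ⟧                   ≡⟨ rearrange (+ n) ⟦ j ⟧ ⟩
      - ⟦ j ⟧ + + 1 * + n           ≈⟨ mod-offset (- ⟦ j ⟧) (+ 1) ⟩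
      - ⟦ j ⟧                       ∎
      where
      rearrange : ∀ N J → N - J ≡ - J + + 1 * N
      rearrange = solve-∀

    ⟦twist⟧ : ∀ e j → ⟦ twist e j ⟧ ≡ σ e * ⟦ j ⟧ mod n
    ⟦twist⟧ false j = mod-reflexive (sym (*-identityˡ ⟦ j ⟧))
    ⟦twist⟧ true  j = mod-trans (⟦negF⟧ j) (mod-reflexive (sym (-1*i≡-i ⟦ j ⟧)))

    ⟦·⟧ : ∀ i e j f → ⟦ proj₁ ((i , e) · (j , f)) ⟧ ≡ ⟦ i ⟧ + σ e * ⟦ j ⟧ mod n
    ⟦·⟧ i e j f = mod-trans (⟦addF⟧ i (twist e j)) (+-congˡ-mod ⟦ i ⟧ (⟦twist⟧ e j))

    ⟦⟧-injective : ∀ {i j} → ⟦ i ⟧ ≡ ⟦ j ⟧ mod n → i ≡ j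
    ⟦⟧-injective {i} {j} p = toℕ-injective (+-injective (i-j≡0⇒i≡j ⟦ i ⟧ ⟦ j ⟧ difference≡0))
      where
      d = ∣ toℕ i ⊖ toℕ j ∣
      n∣d : n ∣ d
      n∣d = subst (λ x → n ∣ ∣ x ∣) (m-n≡m⊖n (toℕ i) (toℕ j)) (∣⇒∣ᵤ (divides-difference p))
      d<n : d ℕ.< n
      d<n = ℕ.≤-<-trans (∣m⊝n∣≤m⊔n (toℕ i) (toℕ j)) (ℕ.⊔-pres-<m (toℕ<n i) (toℕ<n j))
      difference≡0 : ⟦ i ⟧ - ⟦ j ⟧ ≡ 0ℤ
      difference≡0 = trans (m-n≡m⊖n (toℕ i) (toℕ j))
        (∣i∣≡0⇒i≡0 (trans (sym (m<n⇒m%n≡m d<n)) (ℕ.n∣m⇒m%n≡0 d n n∣d)))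

    elem-≡ : ∀ {i j e} → ⟦ i ⟧ ≡ ⟦ j ⟧ mod n → _≡_ {A = Elem} (i , e) (j , e)
    elem-≡ p = cong (_, _) (⟦⟧-injective p)

    σ-xor : ∀ e f → σ (e xor f) ≡ σ e * σ f
    σ-xor false f     = sym (*-identityˡ (σ f))
    σ-xor true  false = refl
    σ-xor true  true  = refl

    right-unit : ∀ i e → ⟦ proj₁ ((i , e) · one) ⟧ ≡ ⟦ i ⟧ mod n
    right-unit i e = begin
      ⟦ proj₁ ((i , e) · one) ⟧   ≈⟨ ⟦·⟧ i e (modn 0) false ⟩
      ⟦ i ⟧ + σ e * ⟦ modn 0 ⟧    ≈⟨ +-congˡ-mod ⟦ i ⟧ (*-cong-mod (σ e) (⟦modn⟧ 0)) ⟩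
      ⟦ i ⟧ + σ e * + 0           ≡⟨ unit ⟦ i ⟧ (σ e) ⟩
      ⟦ i ⟧                       ∎
      where
      unit : ∀ i s → i + s * + 0 ≡ i
      unit = solve-∀

    twiceˡ : ∀ q i e → ⟦ proj₁ ((q , true) · ((q , true) · (i , e))) ⟧ ≡ ⟦ i ⟧ mod n
    twiceˡ q i e = begin
      ⟦ proj₁ ((q , true) · ((q , true) · (i , e))) ⟧
        ≈⟨ ⟦·⟧ q true (proj₁ ((q , true) · (i , e))) (proj₂ ((q , true) · (i , e))) ⟩
      ⟦ q ⟧ + -1ℤ * ⟦ proj₁ ((q , true) · (i , e)) ⟧
        ≈⟨ +-congˡ-mod ⟦ q ⟧ (*-cong-mod -1ℤ (⟦·⟧ q true i e)) ⟩
      ⟦ q ⟧ + -1ℤ * (⟦ q ⟧ + -1ℤ * ⟦ i ⟧)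
        ≡⟨ cancel ⟦ q ⟧ ⟦ i ⟧ ⟩
      ⟦ i ⟧ ∎
      where
      cancel : ∀ q i → q + -1ℤ * (q + -1ℤ * i) ≡ i
      cancel = solve-∀

    twiceʳ : ∀ q i e → ⟦ proj₁ (((i , e) · (q , true)) · (q , true)) ⟧ ≡ ⟦ i ⟧ mod n
    twiceʳ q i e = begin
      ⟦ proj₁ (((i , e) · (q , true)) · (q , true)) ⟧
        ≈⟨ ⟦·⟧ _ (e xor true) q true ⟩
      ⟦ proj₁ ((i , e) · (q , true)) ⟧ + σ (e xor true) * ⟦ q ⟧
        ≈⟨ +-cong-mod (⟦·⟧ i e q true) (mod-reflexive (cong (_* ⟦ q ⟧) (σ-xor e true))) ⟩
      ⟦ i ⟧ + σ e * ⟦ q ⟧ + σ e * -1ℤ * ⟦ q ⟧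
        ≡⟨ cancel ⟦ i ⟧ (σ e) ⟦ q ⟧ ⟩
      ⟦ i ⟧ ∎
      where
      cancel : ∀ i s q → i + s * q + s * -1ℤ * q ≡ i
      cancel = solve-∀

    ·-identityˡ : ∀ x → one · x ≡ x
    ·-identityˡ (j , f) = elem-≡ (begin
      ⟦ proj₁ (one · (j , f)) ⟧   ≈⟨ ⟦·⟧ (modn 0) false j f ⟩
      ⟦ modn 0 ⟧ + + 1 * ⟦ j ⟧    ≈⟨ +-congʳ-mod (+ 1 * ⟦ j ⟧) (⟦modn⟧ 0) ⟩
      + 0 + + 1 * ⟦ j ⟧           ≡⟨ unit ⟦ j ⟧ ⟩
      ⟦ j ⟧                       ∎)
      where
      unit : ∀ j → + 0 + + 1 * j ≡ j
      unit = solve-∀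

    -- (cases on e, so that e xor false computes)
    ·-identityʳ : ∀ x → x · one ≡ x
    ·-identityʳ (i , false) = elem-≡ (right-unit i false)
    ·-identityʳ (i , true)  = elem-≡ (right-unit i true)

    reflection-twiceˡ : ∀ q x → (q , true) · ((q , true) · x) ≡ x
    reflection-twiceˡ q (i , false) = elem-≡ (twiceˡ q i false)
    reflection-twiceˡ q (i , true)  = elem-≡ (twiceˡ q i true)

    reflection-twiceʳ : ∀ q x → (x · (q , true)) · (q , true) ≡ x
    reflection-twiceʳ q (i , false) = elem-≡ (twiceʳ q i false)
    reflection-twiceʳ q (i , true)  = elem-≡ (twiceʳ q i true)

    conj-exponent : ∀ j e k f →
      ⟦ proj₁ (((j , e) · (k , f)) · inv (j , e)) ⟧ ≡ (⟦ j ⟧ - σ f * ⟦ j ⟧) + σ e * ⟦ k ⟧ mod n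
    conj-exponent j false k f = begin
      ⟦ proj₁ ((addF j k , f) · (negF j , false)) ⟧
        ≈⟨ ⟦·⟧ (addF j k) f (negF j) false ⟩
      ⟦ addF j k ⟧ + σ f * ⟦ negF j ⟧
        ≈⟨ +-cong-mod (⟦addF⟧ j k) (*-cong-mod (σ f) (⟦negF⟧ j)) ⟩
      (⟦ j ⟧ + ⟦ k ⟧) + σ f * - ⟦ j ⟧
        ≡⟨ regroup ⟦ j ⟧ ⟦ k ⟧ (σ f) ⟩
      (⟦ j ⟧ - σ f * ⟦ j ⟧) + + 1 * ⟦ k ⟧ ∎
      where
      regroup : ∀ j k s → (j + k) + s * - j ≡ (j - s * j) + + 1 * k
      regroup = solve-∀
    conj-exponent j true k f = begin
      ⟦ proj₁ ((addF j (negF k) , true xor f) · (j , true)) ⟧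
        ≈⟨ ⟦·⟧ (addF j (negF k)) (true xor f) j true ⟩
      ⟦ addF j (negF k) ⟧ + σ (true xor f) * ⟦ j ⟧
        ≈⟨ +-cong-mod (mod-trans (⟦addF⟧ j (negF k)) (+-congˡ-mod ⟦ j ⟧ (⟦negF⟧ k)))
                      (mod-reflexive (cong (_* ⟦ j ⟧) (σ-xor true f))) ⟩
      (⟦ j ⟧ + - ⟦ k ⟧) + -1ℤ * σ f * ⟦ j ⟧
        ≡⟨ regroup ⟦ j ⟧ ⟦ k ⟧ (σ f) ⟩
      (⟦ j ⟧ - σ f * ⟦ j ⟧) + -1ℤ * ⟦ k ⟧ ∎
      where
      regroup : ∀ j k s → (j + - k) + -1ℤ * s * j ≡ (j - s * j) + -1ℤ * k
      regroup = solve-∀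

  _⊆_ : Subset → Subset → Set
  H ⊆ K = ∀ x → x ∈ H → x ∈ K

  ≋-sym : ∀ {H K} → H ≋ K → K ≋ H
  ≋-sym H≋K x = sym (H≋K x)

  ≋-trans : ∀ {H K L} → H ≋ K → K ≋ L → H ≋ L
  ≋-trans H≋K K≋L x = trans (H≋K x) (K≋L x)

  ≋⇒⊆ : ∀ {H K} → H ≋ K → H ⊆ K
  ≋⇒⊆ H≋K x x∈H = trans (sym (H≋K x)) x∈H

  _∈?_ : ∀ x H → Dec (x ∈ H)
  x ∈? H = H x Bool.≟ true

  subgroup-resp : ∀ {H K} → H ≋ K → IsSubgroup H → IsSubgroup K
  subgroup-resp H≋K SH = record
    { one∈ = ≋⇒⊆ H≋K one (one∈ SH)
    ; ·∈   = λ x y x∈ y∈ → ≋⇒⊆ H≋K (x · y) (·∈ SH x y (≋⇒⊆ K≋H x x∈) (≋⇒⊆ K≋H y y∈))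
    ; inv∈ = λ x x∈ → ≋⇒⊆ H≋K (inv x) (inv∈ SH x (≋⇒⊆ K≋H x x∈)) }
    where
    open IsSubgroup
    K≋H = ≋-sym H≋K

  vertex-resp : ∀ {H K} → H ≋ K → IsVertex H → IsVertex K
  vertex-resp H≋K (SH , (x , x∉H) , ¬normal) =
    subgroup-resp H≋K SH ,
    (x , λ x∈K → x∉H (≋⇒⊆ (≋-sym H≋K) x x∈K)) ,
    λ normal → ¬normal λ g h h∈H → ≋⇒⊆ (≋-sym H≋K) _ (normal g h (≋⇒⊆ H≋K h h∈H))

  product-resp : ∀ {H H′ K K′ x} → H ≋ H′ → K ≋ K′ → x ∈[ H · K ] → x ∈[ H′ · K′ ]
  product-resp H≋ K≋ (h , k , h∈ , k∈ , x≡hk) = h , k , ≋⇒⊆ H≋ h h∈ , ≋⇒⊆ K≋ k k∈ , x≡hk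

  permutable-resp : ∀ {H H′ K K′} → H ≋ H′ → K ≋ K′ → Permutable H K → Permutable H′ K′
  permutable-resp H≋ K≋ HK=KH x =
    (λ x∈ → product-resp K≋ H≋ (proj₁ (HK=KH x) (product-resp (≋-sym H≋) (≋-sym K≋) x∈))) ,
    (λ x∈ → product-resp H≋ K≋ (proj₂ (HK=KH x) (product-resp (≋-sym K≋) (≋-sym H≋) x∈)))

  adj-resp : ∀ {H H′ K K′} → H ≋ H′ → K ≋ K′ → Adj H K → Adj H′ K′
  adj-resp H≋ K≋ (vH , vK , H≉K , HK=KH) =
    vertex-resp H≋ vH , vertex-resp K≋ vK ,
    (λ H′≋K′ → H≉K (≋-trans H≋ (≋-trans H′≋K′ (≋-sym K≋)))) ,
    permutable-resp H≋ K≋ HK=KH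

  adj-sym : ∀ {H K} → Adj H K → Adj K H
  adj-sym (vH , vK , H≉K , HK=KH) =
    vK , vH , (λ K≋H → H≉K (≋-sym K≋H)) , (λ x → proj₂ (HK=KH x) , proj₁ (HK=KH x))

  connected-trans : ∀ {H K L} → Connected H K → Connected K L → Connected H L
  connected-trans (here _)      K~L = K~L
  connected-trans (step H-J J~K) K~L = step H-J (connected-trans J~K K~L)

  connected-sym : ∀ {H K} → Connected H K → Connected K H
  connected-sym (here vH)       = here vH
  connected-sym (step H-J J~K) =
    connected-trans (connected-sym J~K) (step (adj-sym H-J) (here (proj₁ H-J)))

  connected-vertexʳ : ∀ {H K} → Connected H K → IsVertex K
  connected-vertexʳ (here vH)     = vH
  connected-vertexʳ (step _ J~K) = connected-vertexʳ J~K

  path-connected : ∀ {P} → IsPath P → ∀ i j → Connected (lookup P i) (lookup P j)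
  path-connected {H ∷ _} p i j = connected-trans (connected-sym (from-head p i)) (from-head p j)
    where
    from-head : ∀ {H P} → IsPath (H ∷ P) → ∀ i → Connected H (lookup (H ∷ P) i)
    from-head (single vH)   Fin.zero    = here vH
    from-head (cons H-K _)  Fin.zero    = here (proj₁ H-K)
    from-head (cons H-K pK) (Fin.suc i) = step H-K (from-head pK i)

  -- Two paths joined by an edge from the last entry of the first to the head of
  -- the second form a path (stated with an edge from every entry, as used below).
  path-++ : ∀ {A : Set} (f : A → Subset) {xs y ys} → IsPath (map f xs) → IsPath (map f (y ∷ ys)) →
            All (λ x → Adj (f x) (f y)) xs → IsPath (map f (xs ++ y ∷ ys))
  path-++ f {_ ∷ []}     (single _) q (x-y ∷ [])  = cons x-y q
  path-++ f {_ ∷ _ ∷ _}  (cons a p) q (_ ∷ x-ys) = cons a (path-++ f p q x-ys)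

  pairwise-distinct : ∀ {P} → AllPairs (λ H K → ¬ H ≋ K) P →
                      ∀ i j → lookup P i ≋ lookup P j → i ≡ j
  pairwise-distinct (_ ∷ _)     Fin.zero    Fin.zero    _ = refl
  pairwise-distinct (H≉ ∷ _)    Fin.zero    (Fin.suc j) e = ⊥-elim (All.lookup H≉ (∈-lookup j) e)
  pairwise-distinct (H≉ ∷ _)    (Fin.suc i) Fin.zero    e = ⊥-elim (All.lookup H≉ (∈-lookup i) (≋-sym e))
  pairwise-distinct (_ ∷ rest)  (Fin.suc i) (Fin.suc j) e = cong Fin.suc (pairwise-distinct rest i j e)

  product-⊆ : ∀ {H K L x} → IsSubgroup L → H ⊆ L → K ⊆ L → x ∈[ H · K ] → x ∈ L
  product-⊆ SL H⊆L K⊆L (h , k , h∈ , k∈ , refl) = IsSubgroup.·∈ SL h k (H⊆L h h∈) (K⊆L k k∈)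

  permutable-⊆ : ∀ {H K} → IsSubgroup H → IsSubgroup K → K ⊆ H → Permutable H K
  permutable-⊆ {H} {K} SH SK K⊆H x =
    (λ x∈HK → one , x , one∈ SK , product-⊆ SH (λ _ h∈ → h∈) K⊆H x∈HK , sym (·-identityˡ x)) ,
    (λ x∈KH → x , one , product-⊆ SH K⊆H (λ _ h∈ → h∈) x∈KH , one∈ SK , sym (·-identityʳ x))
    where open IsSubgroup

  -- Let H, K ⊆ L and let the reflection k₀ ∈ K move every element of L outside H
  -- into H, from either side (this is the situation [L : H] = 2, k₀ ∉ H).  Then
  -- HK = KH: an element x of HK or KH lies in L, and is either in H or equal
  -- to k₀ (k₀ x) = (x k₀) k₀.
  permutable-index-two : ∀ {H K L} q → IsSubgroup H → IsSubgroup K → IsSubgroup L →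
    H ⊆ L → K ⊆ L → (q , true) ∈ K →
    (∀ x → x ∈ L → ¬ x ∈ H → (x · (q , true)) ∈ H × ((q , true) · x) ∈ H) →
    Permutable H K
  permutable-index-two {H} {K} {L} q SH SK SL H⊆L K⊆L k₀∈K swap x = to , from
    where
    open IsSubgroup
    k₀ = (q , true)
    to : x ∈[ H · K ] → x ∈[ K · H ]
    to x∈HK with x ∈? H
    ... | yes x∈H = one , x , one∈ SK , x∈H , sym (·-identityˡ x)
    ... | no  x∉H = k₀ , k₀ · x , k₀∈K , proj₂ (swap x (product-⊆ SL H⊆L K⊆L x∈HK) x∉H) ,
                    sym (reflection-twiceˡ q x)
    from : x ∈[ K · H ] → x ∈[ H · K ]
    from x∈KH with x ∈? H
    ... | yes x∈H = x , one , x∈H , one∈ SK , sym (·-identityʳ x)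
    ... | no  x∉H = x · k₀ , k₀ , proj₁ (swap x (product-⊆ SL K⊆L H⊆L x∈KH) x∉H) , k₀∈K ,
                    sym (reflection-twiceʳ q x)


  bool-≡ : ∀ {b b′ : Bool} → (b ≡ true → b′ ≡ true) → (b′ ≡ true → b ≡ true) → b ≡ b′
  bool-≡ {true}           b⇒b′ _ = sym (b⇒b′ refl)
  bool-≡ {false} {true}   _ b′⇒b = b′⇒b refl
  bool-≡ {false} {false}  _ _    = refl

  does-sound : ∀ {A : Set} (a? : Dec A) → does a? ≡ true → A
  does-sound (yes a) _ = a

  -- The exponent class of the b-part: a^k b^e is in ⟨a^m, a^r b⟩ iff k ≡ offset e r.
  offset : Bool → ℤ → ℤ
  offset false r = 0ℤ
  offset true  r = r

  offset-· : ∀ r e f → offset e r + σ e * offset f r ≡ offset (e xor f) r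
  offset-· r false f     = unit (offset f r)
    where
    unit : ∀ a → + 0 + + 1 * a ≡ a
    unit = solve-∀
  offset-· r true  false = unit r
    where
    unit : ∀ r → r + -1ℤ * + 0 ≡ r
    unit = solve-∀
  offset-· r true  true  = cancel r
    where
    cancel : ∀ r → r + -1ℤ * r ≡ + 0
    cancel = solve-∀

  -- The subset Std m r = ⟨a^m, a^r b⟩ = { a^k : k ≡ 0 } ∪ { a^k b : k ≡ r }  (mod m).
  -- For m ∣ n these are exactly the subgroups of D_n containing a reflection.
  -- Std is opaque: it is used only through the membership criteria ∈Std, Std∈
  -- (which keeps m, r and the element inferable from membership statements).
  opaque
    Std : ℕ → ℤ → Subset
    Std m r (k , e) = does (≟-mod m ⟦ k ⟧ (offset e r))

    ∈Std : ∀ {m r k e} → ⟦ k ⟧ ≡ offset e r mod m → (k , e) ∈ Std m r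
    ∈Std {m} {r} {k} {e} = dec-true (≟-mod m ⟦ k ⟧ (offset e r))

    Std∈ : ∀ {m r k e} → (k , e) ∈ Std m r → ⟦ k ⟧ ≡ offset e r mod m
    Std∈ {m} {r} {k} {e} = does-sound (≟-mod m ⟦ k ⟧ (offset e r))

    Std-resp : ∀ {m r q} → r ≡ q mod m → Std m r ≋ Std m q
    Std-resp r≡q (k , false) = refl
    Std-resp {m} {r} {q} r≡q (k , true) =
      does-⇔ (mk⇔ (λ k≡r → mod-trans k≡r r≡q) (λ k≡q → mod-trans k≡q (mod-sym r≡q)))
             (≟-mod m ⟦ k ⟧ r) (≟-mod m ⟦ k ⟧ q)

  Std-subgroup : ∀ {m} r → m ∣ n → IsSubgroup (Std m r)
  Std-subgroup {m} r m∣n = record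
    { one∈ = ∈Std (mod-divisor m∣n (⟦modn⟧ 0))
    ; ·∈   = closed
    ; inv∈ = inverse }
    where
    open ModReasoning m
    closed : ∀ x y → x ∈ Std m r → y ∈ Std m r → (x · y) ∈ Std m r
    closed (i , e) (j , f) x∈ y∈ = ∈Std (begin
      ⟦ proj₁ ((i , e) · (j , f)) ⟧   ≈⟨ mod-divisor m∣n (⟦·⟧ i e j f) ⟩
      ⟦ i ⟧ + σ e * ⟦ j ⟧             ≈⟨ +-cong-mod (Std∈ x∈) (*-cong-mod (σ e) (Std∈ y∈)) ⟩
      offset e r + σ e * offset f r   ≡⟨ offset-· r e f ⟩
      offset (e xor f) r              ∎)
    inverse : ∀ x → x ∈ Std m r → inv x ∈ Std m r
    inverse (i , false) x∈ = ∈Std (mod-trans (mod-divisor m∣n (⟦negF⟧ i)) (neg-cong-mod (Std∈ x∈)))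
    inverse (i , true)  x∈ = x∈

  Std-⊆ : ∀ {m M r} → m ∣ M → Std M r ⊆ Std m r
  Std-⊆ m∣M (k , e) k∈ = ∈Std (mod-divisor m∣M (Std∈ k∈))

  ⟦·⟧-mod : ∀ {N i j a b} e f → N ∣ n → ⟦ i ⟧ ≡ a mod N → ⟦ j ⟧ ≡ b mod N →
            ⟦ proj₁ ((i , e) · (j , f)) ⟧ ≡ a + σ e * b mod N
  ⟦·⟧-mod {i = i} {j} e f N∣n i≡a j≡b =
    mod-trans (mod-divisor N∣n (⟦·⟧ i e j f)) (+-cong-mod i≡a (*-cong-mod (σ e) j≡b))

  -- Conjugation moves exponents inside Std m r only by even amounts.
  conj-offset : ∀ {m} r → m ∣ 2 → ∀ e f j {k} → k ≡ offset f r mod m →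
                (j - σ f * j) + σ e * k ≡ offset f r mod m
  conj-offset {m} r m∣2 e false j {k} k≡0 = begin
    (j - + 1 * j) + σ e * k      ≈⟨ +-congˡ-mod (j - + 1 * j) (*-cong-mod (σ e) k≡0) ⟩
    (j - + 1 * j) + σ e * 0ℤ     ≡⟨ vanish j (σ e) ⟩
    0ℤ                           ∎
    where
    open ModReasoning m
    vanish : ∀ j s → (j - + 1 * j) + s * 0ℤ ≡ 0ℤ
    vanish = solve-∀
  conj-offset {m} r m∣2 false true j {k} k≡r = begin
    (j - -1ℤ * j) + + 1 * k      ≈⟨ +-congˡ-mod (j - -1ℤ * j) (*-cong-mod (+ 1) k≡r) ⟩
    (j - -1ℤ * j) + + 1 * r      ≡⟨ regroup j r ⟩
    + 2 * j + r                  ≈⟨ +-congʳ-mod r (even≡0 m∣2 j) ⟩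
    0ℤ + r                       ≡⟨ +-identityˡ r ⟩
    r                            ∎
    where
    open ModReasoning m
    regroup : ∀ j r → (j - -1ℤ * j) + + 1 * r ≡ + 2 * j + r
    regroup = solve-∀
  conj-offset {m} r m∣2 true true j {k} k≡r = begin
    (j - -1ℤ * j) + -1ℤ * k      ≈⟨ +-congˡ-mod (j - -1ℤ * j) (*-cong-mod -1ℤ k≡r) ⟩
    (j - -1ℤ * j) + -1ℤ * r      ≡⟨ regroup j r ⟩
    + 2 * (j - r) + r            ≈⟨ +-congʳ-mod r (even≡0 m∣2 (j - r)) ⟩
    0ℤ + r                       ≡⟨ +-identityˡ r ⟩
    r                            ∎
    where
    open ModReasoning m
    regroup : ∀ j r → (j - -1ℤ * j) + -1ℤ * r ≡ + 2 * (j - r) + r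
    regroup = solve-∀

  conj≡ : ∀ {m} r → m ∣ n → m ∣ 2 → ∀ j e k f → (k , f) ∈ Std m r →
          ⟦ proj₁ (((j , e) · (k , f)) · inv (j , e)) ⟧ ≡ offset f r mod m
  conj≡ r m∣n m∣2 j e k f k∈ =
    mod-trans (mod-divisor m∣n (conj-exponent j e k f)) (conj-offset r m∣2 e f ⟦ j ⟧ (Std∈ k∈))

  -- If m ∣ 2 then Std m r is normal.  (The cases on e, f make the b-part of the
  -- conjugate compute to f.)
  Std-normal : ∀ {m} r → m ∣ n → m ∣ 2 → IsNormal (Std m r)
  Std-normal r m∣n m∣2 (j , false) (k , false) k∈ = ∈Std (conj≡ r m∣n m∣2 j false k false k∈)
  Std-normal r m∣n m∣2 (j , false) (k , true)  k∈ = ∈Std (conj≡ r m∣n m∣2 j false k true k∈)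
  Std-normal r m∣n m∣2 (j , true)  (k , false) k∈ = ∈Std (conj≡ r m∣n m∣2 j true k false k∈)
  Std-normal r m∣n m∣2 (j , true)  (k , true)  k∈ = ∈Std (conj≡ r m∣n m∣2 j true k true k∈)

  -- If m ∤ 2 then Std m r is not normal: a (a^r b) a⁻¹ = a^(r+2) b ∉ Std m r.
  Std-not-normal : ∀ {m} r → m ∣ n → ¬ m ∣ 2 → ¬ IsNormal (Std m r)
  Std-not-normal {m} r m∣n m∤2 normal = m∤2 (≡0-mod⇒∣ (+-cancelˡ-mod r (begin
    r + + 2                                            ≡⟨ regroup r ⟩
    (+ 1 - -1ℤ * + 1) + + 1 * r                        ≈⟨ conj-exponent′ ⟨
    ⟦ proj₁ (((a , false) · (h , true)) · inv (a , false)) ⟧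
                                                       ≈⟨ Std∈ (normal (a , false) (h , true) h∈) ⟩
    r                                                  ≡⟨ +-identityʳ r ⟨
    r + 0ℤ                                             ∎)))
    where
    open ModReasoning m
    a = point (+ 1)
    h = point r
    h∈ : (h , true) ∈ Std m r
    h∈ = ∈Std (mod-divisor m∣n (⟦point⟧ r))
    conj-exponent′ : ⟦ proj₁ (((a , false) · (h , true)) · inv (a , false)) ⟧
                     ≡ (+ 1 - -1ℤ * + 1) + + 1 * r mod m
    conj-exponent′ = mod-trans (mod-divisor m∣n (conj-exponent a false h true))
      (+-cong-mod (mod-divisor m∣n (+-cong-mod (⟦point⟧ (+ 1)) (neg-cong-mod (*-cong-mod -1ℤ (⟦point⟧ (+ 1))))))
                  (*-cong-mod (+ 1) (mod-divisor m∣n (⟦point⟧ r))))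
    regroup : ∀ r → r + + 2 ≡ (+ 1 - -1ℤ * + 1) + + 1 * r
    regroup = solve-∀

  Std-proper : ∀ {m} r → m ∣ n → ¬ m ∣ 1 → IsProper (Std m r)
  Std-proper {m} r m∣n m∤1 = (point (+ 1) , false) , λ a∈ →
    m∤1 (≡0-mod⇒∣ (mod-trans (mod-sym (mod-divisor m∣n (⟦point⟧ (+ 1)))) (Std∈ a∈)))

  Std-vertex : ∀ {m} r → m ∣ n → ¬ m ∣ 2 → IsVertex (Std m r)
  Std-vertex r m∣n m∤2 =
    Std-subgroup r m∣n , Std-proper r m∣n (λ m∣1 → m∤2 (ℕ.∣-trans m∣1 (ℕ.1∣ 2))) , Std-not-normal r m∣n m∤2

  -- The rotations of Std m r are the powers of a^m, so Std m r ⊆ Std M q forces M ∣ m.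
  Std-period : ∀ {m M r q} → m ∣ n → M ∣ n → Std m r ⊆ Std M q → M ∣ m
  Std-period {m} {M} m∣n M∣n m⊆M = ≡0-mod⇒∣ (mod-trans (mod-sym (mod-divisor M∣n (⟦point⟧ (+ m))))
    (Std∈ (m⊆M _ (∈Std (mod-trans (mod-divisor m∣n (⟦point⟧ (+ m))) modulus≡0)))))

  Std-injective : ∀ {m M r q} → m ∣ n → M ∣ n → Std m r ≋ Std M q → (m ≡ M) × (r ≡ q mod m)
  Std-injective {m} {M} {r} {q} m∣n M∣n e = m≡M , r≡q
    where
    m≡M : m ≡ M
    m≡M = ℕ.∣-antisym (Std-period M∣n m∣n (≋⇒⊆ (≋-sym e))) (Std-period m∣n M∣n (≋⇒⊆ e))
    h∈ : (point r , true) ∈ Std M q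
    h∈ = ≋⇒⊆ e _ (∈Std (mod-divisor m∣n (⟦point⟧ r)))
    r≡q : r ≡ q mod m
    r≡q = mod-trans (mod-sym (mod-divisor m∣n (⟦point⟧ r)))
                    (subst (⟦ point r ⟧ ≡ q mod_) (sym m≡M) (Std∈ h∈))

  Std-nested-adjacent : ∀ {m M r} → m ∣ M → M ∣ n → m ≢ M → ¬ m ∣ 2 →
                        Adj (Std m r) (Std M r)
  Std-nested-adjacent {r = r} m∣M M∣n m≢M m∤2 =
    Std-vertex r m∣n m∤2 , Std-vertex r M∣n (λ M∣2 → m∤2 (ℕ.∣-trans m∣M M∣2)) ,
    (λ e → m≢M (proj₁ (Std-injective m∣n M∣n e))) ,
    permutable-⊆ (Std-subgroup r m∣n) (Std-subgroup r M∣n) (Std-⊆ m∣M)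
    where
    m∣n = ℕ.∣-trans m∣M M∣n

  -- A divisor 2m of n does not divide m (n ≠ 0 forces m ≠ 0).
  double∤ : ∀ {m} → (2 ℕ.* m) ∣ n → ¬ (2 ℕ.* m) ∣ m
  double∤ {zero}  0∣n _    = ℕ.≢-nonZero⁻¹ n (ℕ.0∣⇒≡0 0∣n)
  double∤ {suc k} _   2m∣m = ℕ.<⇒≱ (ℕ.m<m+n (suc k) (ℕ.s≤s ℕ.z≤n)) (ℕ.∣⇒≤ 2m∣m)

  -- Inside L = Std m r, the subgroup Std 2m r has index 2, and a reflection a^q b
  -- with q ≡ r + m (mod 2m) lies in L outside it: multiplying by a^q b, on either
  -- side, moves every element of L outside Std 2m r into it.
  Std-swap : ∀ {m r q} → (2 ℕ.* m) ∣ n → q ≡ r + + m mod (2 ℕ.* m) →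
             ∀ x → x ∈ Std m r → ¬ x ∈ Std (2 ℕ.* m) r →
             (x · (point q , true)) ∈ Std (2 ℕ.* m) r × ((point q , true) · x) ∈ Std (2 ℕ.* m) r
  Std-swap {m} {r} {q} 2m∣n q≡r+m (i , false) x∈ x∉ with mod-split (Std∈ x∈)
  ... | inj₁ i≡0 = ⊥-elim (x∉ (∈Std i≡0))
  ... | inj₂ i≡m =
    ∈Std (mod-trans (⟦·⟧-mod false true 2m∣n i≡m q′≡r+m)
         (mod-trans (mod-reflexive (regroup r (+ m)))
         (mod-trans (+-congˡ-mod r (double≡0 {m})) (mod-reflexive (+-identityʳ r))))) ,
    ∈Std (mod-trans (⟦·⟧-mod true false 2m∣n q′≡r+m i≡m) (mod-reflexive (cancel r (+ m))))
    where
    q′≡r+m = mod-trans (mod-divisor 2m∣n (⟦point⟧ q)) q≡r+m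
    regroup : ∀ r m → (0ℤ + m) + + 1 * (r + m) ≡ r + (m + m)
    regroup = solve-∀
    cancel : ∀ r m → (r + m) + -1ℤ * (0ℤ + m) ≡ r
    cancel = solve-∀
  Std-swap {m} {r} {q} 2m∣n q≡r+m (i , true) x∈ x∉ with mod-split (Std∈ x∈)
  ... | inj₁ i≡r = ⊥-elim (x∉ (∈Std i≡r))
  ... | inj₂ i≡r+m =
    ∈Std (mod-trans (⟦·⟧-mod true true 2m∣n i≡r+m q′≡r+m) (mod-reflexive (cancel r (+ m)))) ,
    ∈Std (mod-trans (⟦·⟧-mod true true 2m∣n q′≡r+m i≡r+m) (mod-reflexive (cancel r (+ m))))
    where
    q′≡r+m = mod-trans (mod-divisor 2m∣n (⟦point⟧ q)) q≡r+m
    cancel : ∀ r m → (r + m) + -1ℤ * (r + m) ≡ 0ℤ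
    cancel = solve-∀

  -- Siblings: let 2m ∣ M ∣ n and q ≡ r + m (mod 2m).  Both Std 2m r and Std M q lie
  -- in L = Std m r, and Std-swap applies with a^q b ∈ Std M q; so they permute.
  Std-sibling-adjacent : ∀ {m M r q} → (2 ℕ.* m) ∣ M → M ∣ n → ¬ (2 ℕ.* m) ∣ 2 →
                         q ≡ r + + m mod (2 ℕ.* m) → Adj (Std (2 ℕ.* m) r) (Std M q)
  Std-sibling-adjacent {m} {M} {r} {q} 2m∣M M∣n 2m∤2 q≡r+m =
    Std-vertex r 2m∣n 2m∤2 , Std-vertex q M∣n (λ M∣2 → 2m∤2 (ℕ.∣-trans 2m∣M M∣2)) , distinct ,
    permutable-index-two (point q) (Std-subgroup r 2m∣n) (Std-subgroup q M∣n) (Std-subgroup r m∣n)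
      (Std-⊆ m∣2m) K⊆L k₀∈K (Std-swap 2m∣n q≡r+m)
    where
    m∣2m = ℕ.n∣m*n 2
    2m∣n = ℕ.∣-trans 2m∣M M∣n
    m∣n  = ℕ.∣-trans m∣2m 2m∣n
    K⊆L : Std M q ⊆ Std m r
    K⊆L x x∈ = ≋⇒⊆ (Std-resp (mod-trans (mod-divisor m∣2m q≡r+m) (+-multiple-mod r ℕ.∣-refl))) x
                   (Std-⊆ (ℕ.∣-trans m∣2m 2m∣M) x x∈)
    -- equal subgroups would force r ≡ q ≡ r + m, i.e. 2m ∣ m
    distinct : ¬ Std (2 ℕ.* m) r ≋ Std M q
    distinct e = double∤ 2m∣n (≡0-mod⇒∣ (+-cancelˡ-mod r
      (mod-trans (mod-sym (mod-trans r≡q q≡r+m)) (mod-reflexive (sym (+-identityʳ r))))))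
      where r≡q = proj₂ (Std-injective 2m∣n M∣n e)
    k₀∈K : (point q , true) ∈ Std M q
    k₀∈K = ∈Std (mod-divisor M∣n (⟦point⟧ q))

  reflections-product : ∀ {N} r q → N ∣ n →
                        ⟦ proj₁ ((point r , true) · (point q , true)) ⟧ ≡ r + -1ℤ * q mod N
  reflections-product r q N∣n =
    ⟦·⟧-mod true true N∣n (mod-divisor N∣n (⟦point⟧ r)) (mod-divisor N∣n (⟦point⟧ q))

  sub-as-add : ∀ r q → r - q ≡ r + -1ℤ * q
  sub-as-add = solve-∀

  false≢true : false ≢ true
  false≢true ()

  -- If a^r b · a^q b also factors as k h with k ∈ Std M q and
  -- h ∈ Std m r, where 4 ∣ m, M, then either k, h are rotations (so r - q ≡ 0) or
  -- reflections a^x b, a^y b with x ≡ q, y ≡ r (so r - q ≡ q - r), modulo 4.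
  reflections-refactor : ∀ {m M r q} → 4 ∣ m → 4 ∣ M → m ∣ n →
    ((point r , true) · (point q , true)) ∈[ Std M q · Std m r ] → r - q ≡ q - r mod 4
  reflections-refactor {m} {M} {r} {q} 4∣m 4∣M m∣n ((a , false) , (b , false) , a∈ , b∈ , hk≡ab) =
    mod-trans r-q≡0 (mod-sym (mod-trans (mod-reflexive (flip q r)) (neg-cong-mod r-q≡0)))
    where
    open ModReasoning 4
    4∣n = ℕ.∣-trans 4∣m m∣n
    flip : ∀ q r → q - r ≡ - (r - q)
    flip = solve-∀
    r-q≡0 : r - q ≡ 0ℤ mod 4
    r-q≡0 = begin
      r - q                                   ≡⟨ sub-as-add r q ⟩
      r + -1ℤ * q                             ≈⟨ reflections-product r q 4∣n ⟨
      ⟦ proj₁ ((point r , true) · (point q , true)) ⟧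
                                              ≡⟨ cong (λ x → ⟦ proj₁ x ⟧) hk≡ab ⟩
      ⟦ proj₁ ((a , false) · (b , false)) ⟧   ≈⟨ ⟦·⟧-mod false false 4∣n (mod-divisor 4∣M (Std∈ a∈))
                                                                         (mod-divisor 4∣m (Std∈ b∈)) ⟩
      0ℤ                                      ∎
  reflections-refactor {m} {M} {r} {q} 4∣m 4∣M m∣n ((a , true) , (b , true) , a∈ , b∈ , hk≡ab) = begin
    r - q                                   ≡⟨ sub-as-add r q ⟩
    r + -1ℤ * q                             ≈⟨ reflections-product r q 4∣n ⟨
    ⟦ proj₁ ((point r , true) · (point q , true)) ⟧
                                            ≡⟨ cong (λ x → ⟦ proj₁ x ⟧) hk≡ab ⟩
    ⟦ proj₁ ((a , true) · (b , true)) ⟧     ≈⟨ ⟦·⟧-mod true true 4∣n (mod-divisor 4∣M (Std∈ a∈))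
                                                                    (mod-divisor 4∣m (Std∈ b∈)) ⟩
    q + -1ℤ * r                             ≡⟨ sub-as-add q r ⟨
    q - r                                   ∎
    where
    open ModReasoning 4
    4∣n = ℕ.∣-trans 4∣m m∣n
  reflections-refactor _ _ _ ((_ , false) , (_ , true) , _ , _ , hk≡ab) = ⊥-elim (false≢true (cong proj₂ hk≡ab))
  reflections-refactor _ _ _ ((_ , true) , (_ , false) , _ , _ , hk≡ab) = ⊥-elim (false≢true (cong proj₂ hk≡ab))

  -- Parity: if Std m r and Std M q permute, with 4 ∣ m and 4 ∣ M, then r ≡ q (mod 2),
  -- since a^r b · a^q b ∈ Std m r · Std M q = Std M q · Std m r.
  Std-parity : ∀ {m M r q} → 4 ∣ m → 4 ∣ M → m ∣ n → M ∣ n →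
               Permutable (Std m r) (Std M q) → r ≡ q mod 2
  Std-parity {m} {M} {r} {q} 4∣m 4∣M m∣n M∣n HK=KH =
    mod-antisym-halve (reflections-refactor 4∣m 4∣M m∣n (proj₁ (HK=KH (h · k)) (h , k , h∈ , k∈ , refl)))
    where
    h = (point r , true)
    k = (point q , true)
    h∈ : h ∈ Std m r
    h∈ = ∈Std (mod-divisor m∣n (⟦point⟧ r))
    k∈ : k ∈ Std M q
    k∈ = ∈Std (mod-divisor M∣n (⟦point⟧ q))

  rotations-normal : ∀ {H} → IsSubgroup H → (∀ c → ¬ (c , true) ∈ H) → IsNormal H
  rotations-normal {H} SH none (j , false) (k , false) k∈ =
    subst (_∈ H) (sym (elem-≡ (mod-trans (conj-exponent j false k false)
                                         (mod-reflexive (vanish ⟦ j ⟧ ⟦ k ⟧))))) k∈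
    where
    vanish : ∀ j k → (j - + 1 * j) + + 1 * k ≡ k
    vanish = solve-∀
  rotations-normal {H} SH none (j , true) (k , false) k∈ =
    subst (_∈ H) (sym (elem-≡ (mod-trans (conj-exponent j true k false)
      (mod-trans (mod-reflexive (vanish ⟦ j ⟧ ⟦ k ⟧)) (mod-sym (⟦negF⟧ k))))))
      (IsSubgroup.inv∈ SH (k , false) k∈)
    where
    vanish : ∀ j k → (j - + 1 * j) + -1ℤ * k ≡ - k
    vanish = solve-∀
  rotations-normal SH none g (k , true) k∈ = ⊥-elim (none k k∈)

  a^ : ℕ → Elem
  a^ k = point (+ k) , false

  a^-+ : ∀ j k → a^ (j ℕ.+ k) ≡ a^ j · a^ k
  a^-+ j k = elem-≡ (mod-trans (⟦point⟧ (+ j + + k))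
    (mod-trans (+-congˡ-mod (+ j) (mod-reflexive (sym (*-identityˡ (+ k)))))
               (mod-sym (⟦·⟧-mod false false ℕ.∣-refl (⟦point⟧ (+ j)) (⟦point⟧ (+ k))))))

  a^-zero : ∀ {k} → + k ≡ 0ℤ mod n → a^ k ≡ one
  a^-zero k≡0 = elem-≡ (mod-trans (⟦point⟧ _) (mod-trans k≡0 (mod-sym (⟦modn⟧ 0))))

  -- The structure of a subgroup H with least positive rotation a^m (m = 1 + j₀)
  -- and a reflection a^c b: it is Std m c, and m ∣ n.
  module Structure {H : Subset} (SH : IsSubgroup H) (j₀ : ℕ) (a^m-least : Least (λ j → a^ (suc j) ∈ H) j₀)
                   (c : Fin n) (c∈H : (c , true) ∈ H) where
    open IsSubgroup SH

    m : ℕ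
    m = suc j₀

    multiple∈H : ∀ t → a^ (t ℕ.* m) ∈ H
    multiple∈H zero    = subst (_∈ H) (sym (a^-zero (mod-reflexive refl))) one∈
    multiple∈H (suc t) = subst (_∈ H) (sym (a^-+ m (t ℕ.* m))) (·∈ _ _ (proj₁ a^m-least) (multiple∈H t))

    -- a^k ∈ H forces m ∣ k: a^(k mod m) = a^k (a^(⌊k/m⌋ m))⁻¹ ∈ H and k mod m < m.
    period-∣ : ∀ k → a^ k ∈ H → m ∣ k
    period-∣ k a^k∈H = ℕ.m%n≡0⇒n∣m k m (remainder≡0 (k % m) refl)
      where
      Q = + (k / m ℕ.* m)
      remainder : a^ (k % m) ≡ a^ k · inv (a^ (k / m ℕ.* m))
      remainder = elem-≡ (begin
        ⟦ point (+ (k % m)) ⟧               ≈⟨ ⟦point⟧ _ ⟩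
        + (k % m)                           ≡⟨ shift (+ (k % m)) Q ⟩
        (+ (k % m) + Q) + + 1 * - Q         ≡⟨ cong (λ x → + x + + 1 * - Q) (m≡m%n+[m/n]*n k m) ⟨
        + k + + 1 * - Q                     ≈⟨ ⟦·⟧-mod false false ℕ.∣-refl (⟦point⟧ (+ k))
                                                 (mod-trans (⟦negF⟧ (point Q)) (neg-cong-mod (⟦point⟧ Q))) ⟨
        ⟦ proj₁ (a^ k · inv (a^ (k / m ℕ.* m))) ⟧ ∎)
        where
        open ModReasoning n
        shift : ∀ r Q → r ≡ (r + Q) + + 1 * - Q
        shift = solve-∀
      remainder∈H : a^ (k % m) ∈ H
      remainder∈H = subst (_∈ H) (sym remainder) (·∈ _ _ a^k∈H (inv∈ _ (multiple∈H (k / m))))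
      remainder≡0 : ∀ ρ → k % m ≡ ρ → ρ ≡ 0
      remainder≡0 zero    _    = refl
      remainder≡0 (suc j) k%m≡ = ⊥-elim (proj₂ a^m-least
        (ℕ.≤-pred (subst (ℕ._< m) k%m≡ (m%n<n k m))) (subst (λ ρ → a^ ρ ∈ H) k%m≡ remainder∈H))

    m∣n : m ∣ n
    m∣n = period-∣ n (subst (_∈ H) (sym (a^-zero modulus≡0)) one∈)

    rotation⁺ : ∀ i → ⟦ i ⟧ ≡ 0ℤ mod m → (i , false) ∈ H
    rotation⁺ i i≡0 = subst (_∈ H) (elem-≡ (mod-trans (⟦point⟧ _) (mod-reflexive (cong +_ (sym i≡tm)))))
                            (multiple∈H t)
      where
      m∣i = ≡0-mod⇒∣ i≡0
      t = ℕ.quotient m∣i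
      i≡tm = ℕ.m∣n⇒n≡quotient*m m∣i

    rotation⁻ : ∀ i → (i , false) ∈ H → ⟦ i ⟧ ≡ 0ℤ mod m
    rotation⁻ i i∈H = ∣⇒≡0-mod (∣ᵤ⇒∣ (period-∣ (toℕ i)
      (subst (_∈ H) (elem-≡ (mod-sym (⟦point⟧ ⟦ i ⟧))) i∈H)))

    reflection⁺ : ∀ k → ⟦ k ⟧ ≡ ⟦ c ⟧ mod m → (k , true) ∈ H
    reflection⁺ k k≡c = subst (_∈ H) (reflection-twiceʳ c (k , true))
      (·∈ _ _ (rotation⁺ _ (mod-trans (⟦·⟧-mod true true m∣n k≡c (mod-reflexive {a = ⟦ c ⟧} refl))
                                      (mod-reflexive (cancel ⟦ c ⟧)))) c∈H)
      where
      cancel : ∀ c → c + -1ℤ * c ≡ 0ℤ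
      cancel = solve-∀

    reflection⁻ : ∀ k → (k , true) ∈ H → ⟦ k ⟧ ≡ ⟦ c ⟧ mod m
    reflection⁻ k k∈H = begin
      ⟦ k ⟧                                   ≡⟨ shift ⟦ k ⟧ ⟦ c ⟧ ⟩
      (⟦ k ⟧ + -1ℤ * ⟦ c ⟧) + ⟦ c ⟧           ≈⟨ +-congʳ-mod ⟦ c ⟧ (mod-divisor m∣n (⟦·⟧ k true c true)) ⟨
      ⟦ proj₁ ((k , true) · (c , true)) ⟧ + ⟦ c ⟧
                                              ≈⟨ +-congʳ-mod ⟦ c ⟧ (rotation⁻ _ (·∈ _ _ k∈H c∈H)) ⟩
      0ℤ + ⟦ c ⟧                              ≡⟨ +-identityˡ ⟦ c ⟧ ⟩
      ⟦ c ⟧                                   ∎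
      where
      open ModReasoning m
      shift : ∀ k c → k ≡ (k + -1ℤ * c) + c
      shift = solve-∀

    H≋Std : H ≋ Std m ⟦ c ⟧
    H≋Std (k , false) = bool-≡ (λ k∈ → ∈Std (rotation⁻ k k∈))   (λ k∈ → rotation⁺ k (Std∈ k∈))
    H≋Std (k , true)  = bool-≡ (λ k∈ → ∈Std (reflection⁻ k k∈)) (λ k∈ → reflection⁺ k (Std∈ k∈))

  -- Every vertex H is Std m r with m ∣ n: H contains a reflection (else it would be
  -- normal) and a least positive rotation (as a^n = 1); and m ∤ 2, else H is normal.
  classify : ∀ {H} → IsVertex H → ∃[ m ] ∃[ r ] ((m ∣ n) × ¬ (m ∣ 2) × (H ≋ Std m r))
  classify {H} vH@(SH , _ , ¬normal) with any? (λ c → (c , true) ∈? H)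
  ... | no  none         = ⊥-elim (¬normal (rotations-normal SH (λ c c∈ → none (c , c∈))))
  ... | yes (c , c∈H)    = m , ⟦ c ⟧ , m∣n , m∤2 , H≋Std
    where
    open IsSubgroup SH
    period : ∃[ j ] Least (λ j → a^ (suc j) ∈ H) j
    period = least (λ j → a^ (suc j) ∈? H) (ℕ.pred n)
      (subst (λ k → a^ k ∈ H) (sym (ℕ.suc-pred n)) (subst (_∈ H) (sym (a^-zero modulus≡0)) one∈))
    open Structure SH (proj₁ period) (proj₂ period) c c∈H
    m∤2 : ¬ m ∣ 2
    m∤2 m∣2 = ¬normal λ g h h∈ → ≋⇒⊆ (≋-sym H≋Std) _ (Std-normal ⟦ c ⟧ m∣n m∣2 g h (≋⇒⊆ H≋Std h h∈))

module Dyadic (β : ℕ) where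

  α : ℕ
  α = suc (suc β)

  instance
    2^α≢0 : ℕ.NonZero (2 ^ α)
    2^α≢0 = m^n≢0 2 α

  open DihedralFacts (2 ^ α)

  Code : Set
  Code = ℕ × ℤ

  ⟪_⟫ : Code → Subset
  ⟪ s , r ⟫ = Std (2 ^ s) r

  code-vertex : ∀ {s} r → 2 ≤ s → s ≤ α → IsVertex ⟪ s , r ⟫
  code-vertex r 2≤s s≤α = Std-vertex r (pow-∣ s≤α) (pow∤2 2≤s)

  record Coded (H : Subset) : Set where
    constructor coded
    field
      level   : ℕ
      residue : ℤ
      2≤level : 2 ≤ level
      level≤α : level ≤ α
      ≋code   : H ≋ ⟪ level , residue ⟫

  vertex-code : ∀ {H} → IsVertex H → Coded H
  vertex-code vH with classify vH
  ... | m , r , m∣n , m∤2 , H≋ with divisor-of-power α m∣n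
  ...   | s , s≤α , refl = coded s r (pow∤2⇒2≤ m∤2) s≤α H≋

  code-injective : ∀ {s t r q} → s ≤ α → t ≤ α → ⟪ s , r ⟫ ≋ ⟪ t , q ⟫ → (s ≡ t) × (r ≡ q mod 2 ^ s)
  code-injective s≤α t≤α e =
    pow-injective (proj₁ same) , proj₂ same
    where same = Std-injective (pow-∣ s≤α) (pow-∣ t≤α) e

  level-apart : ∀ {s t r q} → s < t → t ≤ α → ¬ ⟪ s , r ⟫ ≋ ⟪ t , q ⟫
  level-apart s<t t≤α e = ℕ.<-irrefl (proj₁ (code-injective (ℕ.≤-trans (ℕ.<⇒≤ s<t) t≤α) t≤α e)) s<t

  halves-apart : ∀ {s t t′ r q q′} → suc s ≤ t → t ≤ α → t′ ≤ α →
                 q ≡ r mod 2 ^ suc s → q′ ≡ r + + (2 ^ s) mod 2 ^ suc s → ¬ ⟪ t , q ⟫ ≋ ⟪ t′ , q′ ⟫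
  halves-apart {s} {r = r} s<t t≤α t′≤α q≡r q′≡r+ e =
    pow-suc∤ s (≡0-mod⇒∣ (+-cancelˡ-mod r (mod-trans (mod-sym q′≡r+)
      (mod-trans (mod-sym q≡q′) (mod-trans q≡r (mod-reflexive (sym (+-identityʳ r))))))))
    where
    q≡q′ = mod-divisor (pow-∣ s<t) (proj₂ (code-injective t≤α t′≤α e))

  child-adjacent : ∀ {s} r → 2 ≤ s → suc s ≤ α → Adj ⟪ s , r ⟫ ⟪ suc s , r ⟫
  child-adjacent {s} r 2≤s s<α = Std-nested-adjacent (pow-∣ (ℕ.n≤1+n s)) (pow-∣ s<α)
    (λ e → ℕ.<-irrefl e (pow-< (ℕ.n<1+n s))) (pow∤2 2≤s)

  sibling-adjacent : ∀ {u t r q} → 1 ≤ u → suc u ≤ t → t ≤ α → q ≡ r mod 2 ^ suc u →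
                     Adj ⟪ t , q ⟫ ⟪ suc u , r + + (2 ^ u) ⟫
  sibling-adjacent {u} {t} {r} {q} 1≤u u<t t≤α q≡r =
    adj-sym (Std-sibling-adjacent (pow-∣ u<t) (pow-∣ t≤α) (pow∤2 (s≤s 1≤u)) q≡r+2^u+2^u)
    where
    q≡r+2^u+2^u : q ≡ (r + + (2 ^ u)) + + (2 ^ u) mod 2 ^ suc u
    q≡r+2^u+2^u = mod-trans q≡r (mod-sym (mod-trans (mod-reflexive (+-assoc r _ _))
      (mod-trans (+-congˡ-mod r (double≡0 {2 ^ u})) (mod-reflexive (+-identityʳ r)))))

  descend : ∀ {s d k} → s ℕ.+ suc d ≤ k → suc s ℕ.+ d ≤ k
  descend {s} {d} {k} = subst (_≤ k) (ℕ.+-suc s d)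

  below : ℕ → ℕ → ℤ → List Code
  below zero    s r = []
  below (suc d) s r = ((suc s , r) ∷ below d (suc s) r) ++ ((suc s , r′) ∷ below d (suc s) r′)
    where r′ = r + + (2 ^ s)

  subtree : ℕ → ℕ → ℤ → List Code
  subtree d s r = (s , r) ∷ below d s r

  InSubtree : ℕ → ℕ → ℤ → Code → Set
  InSubtree d s r (t , q) = s ≤ t × t ≤ s ℕ.+ d × q ≡ r mod 2 ^ s

  to-parent : ∀ {d s r r′} → r′ ≡ r mod 2 ^ s → ∀ {x} → InSubtree d (suc s) r′ x → InSubtree (suc d) s r x
  to-parent {d} {s} r′≡r {t , q} (s<t , t≤ , q≡r′) =
    ℕ.≤-trans (ℕ.n≤1+n s) s<t , subst (t ≤_) (sym (ℕ.+-suc s d)) t≤ ,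
    mod-trans (mod-divisor (pow-∣ (ℕ.n≤1+n s)) q≡r′) r′≡r

  subtree-nodes : ∀ d s r → All (InSubtree d s r) (subtree d s r)
  subtree-nodes d s r = (ℕ.≤-refl , ℕ.m≤m+n s d , mod-reflexive refl) ∷ below-nodes d
    where
    below-nodes : ∀ d → All (InSubtree d s r) (below d s r)
    below-nodes zero    = []
    below-nodes (suc d) = Allₚ.++⁺
      (All.map (to-parent (mod-reflexive refl)) (subtree-nodes d (suc s) r))
      (All.map (to-parent (+-multiple-mod r ℕ.∣-refl)) (subtree-nodes d (suc s) (r + + (2 ^ s))))

  Apart : Code → Code → Set
  Apart x y = ¬ ⟪ x ⟫ ≋ ⟪ y ⟫

  subtree-apart : ∀ d s r → s ℕ.+ d ≤ α → AllPairs Apart (subtree d s r)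
  subtree-apart zero    s r _    = [] ∷ []
  subtree-apart (suc d) s r bound =
    Allₚ.++⁺ (All.map root-apart (subtree-nodes d (suc s) r))
             (All.map root-apart (subtree-nodes d (suc s) r′)) ∷
    AllPairsₚ.++⁺ (subtree-apart d (suc s) r bound′) (subtree-apart d (suc s) r′ bound′)
      (All.map (λ {x} x∈ → All.map (λ {y} y∈ → across x y x∈ y∈) (subtree-nodes d (suc s) r′))
               (subtree-nodes d (suc s) r))
    where
    r′ = r + + (2 ^ s)
    bound′ = descend bound
    depth : ∀ {t} → t ≤ suc s ℕ.+ d → t ≤ α
    depth t≤ = ℕ.≤-trans t≤ bound′
    root-apart : ∀ {ρ x} → InSubtree d (suc s) ρ x → Apart (s , r) x
    root-apart (s<t , t≤ , _) = level-apart s<t (depth t≤)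
    across : ∀ x y → InSubtree d (suc s) r x → InSubtree d (suc s) r′ y → Apart x y
    across (t , q) (t′ , q′) (s<t , t≤ , q≡r) (_ , t′≤ , q′≡r′) =
      halves-apart s<t (depth t≤) (depth t′≤) q≡r q′≡r′

  -- Preorder is a path: (s , r) is adjacent to its first child, and the last node of
  -- the first child's subtree, like every node there, is adjacent to the second child.
  subtree-path : ∀ d s r → 2 ≤ s → s ℕ.+ d ≤ α → IsPath (map ⟪_⟫ (subtree d s r))
  below-path   : ∀ d s r → 1 ≤ s → s ℕ.+ suc d ≤ α → IsPath (map ⟪_⟫ (below (suc d) s r))

  subtree-path zero    s r 2≤s bound = single (code-vertex r 2≤s (subst (_≤ α) (ℕ.+-identityʳ s) bound))
  subtree-path (suc d) s r 2≤s bound =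
    cons (child-adjacent r 2≤s (ℕ.≤-trans (ℕ.m≤m+n (suc s) d) (descend bound)))
         (below-path d s r (ℕ.≤-trans (s≤s z≤n) 2≤s) bound)

  below-path d s r 1≤s bound =
    path-++ ⟪_⟫ (subtree-path d (suc s) r (s≤s 1≤s) bound′)
                (subtree-path d (suc s) (r + + (2 ^ s)) (s≤s 1≤s) bound′)
                (All.map (λ { {t , q} (s<t , t≤ , q≡r) → sibling-adjacent 1≤s s<t (ℕ.≤-trans t≤ bound′) q≡r })
                         (subtree-nodes d (suc s) r))
    where bound′ = descend bound

  subtree-covers : ∀ d s r {t q} → InSubtree d s r (t , q) → Any (λ x → ⟪ x ⟫ ≋ ⟪ t , q ⟫) (subtree d s r)
  below-covers   : ∀ d s r {t q} → s < t → t ≤ s ℕ.+ d → q ≡ r mod 2 ^ s →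
                   Any (λ x → ⟪ x ⟫ ≋ ⟪ t , q ⟫) (below d s r)

  subtree-covers d s r (s≤t , t≤ , q≡r) with ℕ.m≤n⇒m<n∨m≡n s≤t
  ... | inj₂ refl = here (Std-resp (mod-sym q≡r))
  ... | inj₁ s<t  = there (below-covers d s r s<t t≤ q≡r)

  below-covers zero    s r s<t t≤s+0 _ = ⊥-elim (ℕ.<⇒≱ s<t (subst (_ ≤_) (ℕ.+-identityʳ s) t≤s+0))
  below-covers (suc d) s r {t} s<t t≤ q≡r with mod-split q≡r
  ... | inj₁ q≡r  = Anyₚ.++⁺ˡ (subtree-covers d (suc s) r (s<t , t≤′ , q≡r))
    where t≤′ = subst (t ≤_) (ℕ.+-suc s d) t≤
  ... | inj₂ q≡r′ = Anyₚ.++⁺ʳ (subtree d (suc s) r) (subtree-covers d (suc s) _ (s<t , t≤′ , q≡r′))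
    where t≤′ = subst (t ≤_) (ℕ.+-suc s d) t≤

  adjacent-parity : ∀ {H K s r t q} → Adj H K → 2 ≤ s → s ≤ α → H ≋ ⟪ s , r ⟫ →
                    2 ≤ t → t ≤ α → K ≋ ⟪ t , q ⟫ → r ≡ q mod 2
  adjacent-parity (_ , _ , _ , HK=KH) 2≤s s≤α H≋ 2≤t t≤α K≋ =
    Std-parity (pow-∣ 2≤s) (pow-∣ 2≤t) (pow-∣ s≤α) (pow-∣ t≤α) (permutable-resp H≋ K≋ HK=KH)

  connected-parity : ∀ {H K s r t q} → Connected H K → 2 ≤ s → s ≤ α → H ≋ ⟪ s , r ⟫ →
                     2 ≤ t → t ≤ α → K ≋ ⟪ t , q ⟫ → r ≡ q mod 2
  connected-parity (here _) 2≤s s≤α H≋ _ t≤α K≋ =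
    mod-divisor (pow-∣ (ℕ.≤-trans (s≤s z≤n) 2≤s)) (proj₂ (code-injective s≤α t≤α (≋-trans (≋-sym H≋) K≋)))
  connected-parity (step H-J J~K) 2≤s s≤α H≋ 2≤t t≤α K≋ =
    mod-trans (adjacent-parity H-J 2≤s s≤α H≋ 2≤level level≤α ≋code)
              (connected-parity J~K 2≤level level≤α ≋code 2≤t t≤α K≋)
    where open Coded (vertex-code (proj₁ (proj₂ H-J)))

  -- The component of a vertex with code (s , c): the codes (t , q) with 2 ≤ t ≤ α and
  -- q ≡ c (mod 2), i.e. the tree below the normal subgroup ⟪ 1 , c ⟫, listed in preorder.
  component : ℤ → List Subset
  component c = map ⟪_⟫ (below (suc β) 1 c)

  in-component : ∀ {c t q} → 2 ≤ t → t ≤ α → q ≡ c mod 2 → ∃[ i ] (lookup (component c) i ≋ ⟪ t , q ⟫)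
  in-component {c} {t} {q} 2≤t t≤α q≡c =
    Any.index found , Anyₚ.lookup-index found
    where
    found : Any (_≋ ⟪ t , q ⟫) (component c)
    found = Anyₚ.map⁺ (below-covers (suc β) 1 c 2≤t t≤α q≡c)

  hamiltonian : ∀ {V s c} → 2 ≤ s → s ≤ α → V ≋ ⟪ s , c ⟫ → HamiltonianPathOfComponent V (component c)
  hamiltonian {V} {suc u} {c} (s≤s 1≤u) s≤α V≋ = record
    { isPath   = path
    ; inComp   = λ i → step V-sibling (path-connected path (proj₁ sibling) i)
    ; distinct = pairwise-distinct (AllPairsₚ.map⁺ (AllPairs.tail (subtree-apart (suc β) 1 c ℕ.≤-refl)))
    ; covers   = covers }
    where
    path : IsPath (component c)
    path = below-path β 1 c ℕ.≤-refl ℕ.≤-refl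
    -- V is adjacent to its sibling ⟪ s , c + 2^u ⟫, which is on the path
    sibling : ∃[ i ] (lookup (component c) i ≋ ⟪ suc u , c + + (2 ^ u) ⟫)
    sibling = in-component (s≤s 1≤u) s≤α (+-multiple-mod c (pow-∣ 1≤u))
    V-sibling : Adj V (lookup (component c) (proj₁ sibling))
    V-sibling = adj-resp (≋-sym V≋) (≋-sym (proj₂ sibling)) (sibling-adjacent 1≤u ℕ.≤-refl s≤α (mod-reflexive refl))
    covers : ∀ W → Connected V W → ∃[ i ] (lookup (component c) i ≋ W)
    covers W V~W = proj₁ W-listed , ≋-trans (proj₂ W-listed) (≋-sym ≋code)
      where
      open Coded (vertex-code (connected-vertexʳ V~W))
      W-listed = in-component 2≤level level≤α
        (mod-sym (connected-parity V~W (s≤s 1≤u) s≤α V≋ 2≤level level≤α ≋code))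

theorem4p7 : (α : ℕ) → 2 ≤ α →
    let open Dihedral (2 ^ α) {{m^n≢0 2 α}} in
    (V : Subset) → IsVertex V → ∃[ P ] HamiltonianPathOfComponent V P
theorem4p7 .(suc (suc β)) (s≤s (s≤s {n = β} z≤n)) V vertex =
  component residue , hamiltonian 2≤level level≤α ≋code
  where
  open Dyadic β
  open Coded (vertex-code vertex)
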